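{- Let $m \geq 1$ be an integer. Let $\sigma_m, \tau_m : \mathbb{Z}_2^{2m} \to \mathbb{Z}_2$ be the functions defined in the context, and let $\mathrm{Cay}(\sigma_m)$ and $\mathrm{Cay}(\tau_m)$ be their Cayley graphs. Then $\mathrm{Cay}(\sigma_m)$ and $\mathrm{Cay}(\tau_m)$ are isomorphic (as simple undirected graphs) only when $m = 1$, $2$, or $3$.
   Context: Identify each $i \in \mathbb{Z}_2^{2m}$ with a bit string of length $2m$, and read it as an $m$-digit base-4 number by grouping consecutive pairs of bits, each pair $(b_{2k+1}, b_{2k})$ giving the base-4 digit $2b_{2k+1}+b_{2k} \in \{0,1,2,3\}$. Define $\sigma_m(i) = 1$ if and only if the number of base-4 digits of $i$ equal to $1$ is odd, and $\sigma_m(i)=0$ otherwise. Define $\tau_m(i) = 1$ if and only if the number of base-4 digits of $i$ equal to $1$ or $2$ is nonzero and the number of base-4 digits of $i$ equal to $1$ is even, and $\tau_m(i)=0$ otherwise. For a function $f:\mathbb{Z}_2^{2m}\to\mathbb{Z}_2$ with $f(0)=0$, the Cayley graph $\mathrm{Cay}(f)$ is the simple undirected graph with vertex set $\mathbb{Z}_2^{2m}$ in which distinct vertices $i,j$ are adjacent if and only if $f(i+j)=1$ (addition in $\mathbb{Z}_2^{2m}$). -}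

module Defs where

open import Data.Bool using (Bool; true; false; _xor_; _∧_; not)
open import Data.Nat using (ℕ; zero; suc; _+_)
open import Data.Product using (_×_; _,_; Σ)
open import Data.Vec using (Vec; []; _∷_; zipWith)
open import Relation.Binary.PropositionalEquality using (_≡_)
open import Relation.Nullary using (¬_)
open import Function.Bundles using (_⤖_; _⇔_; Bijection)

-- An element of ℤ₂^{2m}, grouped into m consecutive bit pairs.
-- Each pair is (b_{2k+1} , b_{2k}) and represents the base-4 digit
-- 2·b_{2k+1} + b_{2k}.
V : ℕ → Set
V m = Vec (Bool × Bool) m

_⊕_ : ∀ {m} → V m → V m → V m
_⊕_ = zipWith (λ { (a , b) (c , d) → (a xor c , b xor d) })

isDigit1 : Bool × Bool → Bool
isDigit1 (false , true) = true
isDigit1 _ = false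

isDigit2 : Bool × Bool → Bool
isDigit2 (true , false) = true
isDigit2 _ = false

b2n : Bool → ℕ
b2n true = 1
b2n false = 0

count1 : ∀ {m} → V m → ℕ
count1 [] = 0
count1 (d ∷ ds) = b2n (isDigit1 d) + count1 ds

count12 : ∀ {m} → V m → ℕ
count12 [] = 0
count12 (d ∷ ds) = b2n (isDigit1 d) + b2n (isDigit2 d) + count12 ds

isOdd : ℕ → Bool
isOdd zero = false
isOdd (suc n) = not (isOdd n)

isNonzero : ℕ → Bool
isNonzero zero = false
isNonzero (suc _) = true

σ : (m : ℕ) → V m → Bool
σ m i = isOdd (count1 i)

τ : (m : ℕ) → V m → Bool
τ m i = isNonzero (count12 i) ∧ not (isOdd (count1 i))

CayAdj : ∀ {m} → (V m → Bool) → V m → V m → Set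
CayAdj f i j = ¬ (i ≡ j) × (f (i ⊕ j) ≡ true)

CayIsomorphic : ∀ {m} → (V m → Bool) → (V m → Bool) → Set
CayIsomorphic {m} f g =
  Σ (V m ⤖ V m) λ φ →
    ∀ i j → CayAdj f i j ⇔ CayAdj g (Bijection.to φ i) (Bijection.to φ j)

-- A Cayley isomorphism φ from Cay(f) to Cay(g) satisfies f (i ⊕ j) = g (φ i ⊕ φ j), so it
-- preserves the property that any three vertices x, y, z have a fourth w such that the parity
-- of the number of neighbours of t among x, y, z, w does not depend on t. σ is a quadratic
-- form (a sum over the digits of a function of two bits), so w = x ⊕ y ⊕ z works for it. For
-- τ with m ≥ 4 the property fails already for x = 0 and two unit vectors: τ of a vector
-- depends on the digits beyond the fourth only through two bits, so an exhaustive search over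
-- the first four digits refutes every candidate w.
module Submission where

open import Defs
open import Data.Nat using (ℕ; _≤_)
open import Data.Sum using (_⊎_)
open import Relation.Binary.PropositionalEquality using (_≡_)

open import Algebra.Bundles using (CommutativeRing)
open import Data.Bool using (Bool; true; false; not; _∧_; _∨_; _xor_)
open import Data.Bool.Properties
  using (_≟_; xor-same; xor-identityʳ; not-distribˡ-xor; ⇔→≡; xor-∧-commutativeRing)
open import Data.Empty using (⊥; ⊥-elim)
open import Data.Nat using (zero; suc; _+_)
open import Data.Nat.Properties using (+-assoc)
open import Data.Product using (_×_; _,_; proj₁; proj₂; ∃-syntax)
open import Data.Sum using (inj₁; inj₂)
open import Data.Vec using (Vec; []; _∷_; _++_; replicate; splitAt)
open import Data.Vec.Properties using (zipWith-identityˡ; zipWith-identityʳ)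
open import Function using (_∘_)
open import Function.Bundles using (_⇔_; mk⇔; Bijection)
open import Function.Properties.Equivalence using () renaming (sym to ⇔-sym; trans to ⇔-trans)
open import Level using (0ℓ)
open import Relation.Binary.PropositionalEquality
  using (_≗_; refl; sym; trans; cong; cong₂; subst₂)
open import Relation.Nullary using (¬_; Dec; map′; _×-dec_; ¬?; from-yes)
open import Relation.Unary using (Pred; Decidable)

open import Algebra.Properties.CommutativeSemigroup
  (CommutativeRing.+-commutativeSemigroup xor-∧-commutativeRing) using (interchange)

Searchable : Set → Set₁
Searchable A = ∀ {P : Pred A 0ℓ} → Decidable P → Dec (∀ a → P a)

searchable-Bool : Searchable Bool
searchable-Bool P? =
  map′ (λ (pt , pf) → λ { true → pt ; false → pf }) (λ h → h true , h false)
       (P? true ×-dec P? false)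

searchable-× : ∀ {A B} → Searchable A → Searchable B → Searchable (A × B)
searchable-× searchA searchB P? =
  map′ (λ h (a , b) → h a b) (λ h a b → h (a , b))
       (searchA λ a → searchB λ b → P? (a , b))

searchable-Vec : ∀ {A} → Searchable A → ∀ n → Searchable (Vec A n)
searchable-Vec searchA zero P? = map′ (λ p → λ { [] → p }) (λ h → h []) (P? [])
searchable-Vec searchA (suc n) P? =
  map′ (λ h → λ { (a ∷ v) → h a v }) (λ h a v → h (a ∷ v))
       (searchA λ a → searchable-Vec searchA n λ v → P? (a ∷ v))

Digit : Set
Digit = Bool × Bool

searchable-Digit : Searchable Digit
searchable-Digit = searchable-× searchable-Bool searchable-Bool

_⊕ᵈ_ : Digit → Digit → Digit
(a , b) ⊕ᵈ (c , d) = a xor c , b xor d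

𝟎 : ∀ m → V m
𝟎 m = replicate m (false , false)

⊕-identityˡ : ∀ {m} (v : V m) → 𝟎 m ⊕ v ≡ v
⊕-identityˡ = zipWith-identityˡ λ _ → refl

⊕-identityʳ : ∀ {m} (v : V m) → v ⊕ 𝟎 m ≡ v
⊕-identityʳ = zipWith-identityʳ λ (a , b) → cong₂ _,_ (xor-identityʳ a) (xor-identityʳ b)

⊕-self : ∀ {m} (v : V m) → v ⊕ v ≡ 𝟎 m
⊕-self [] = refl
⊕-self ((a , b) ∷ v) = cong₂ _∷_ (cong₂ _,_ (xor-same a) (xor-same b)) (⊕-self v)

⊕-++ : ∀ {k n} (a b : V k) (c d : V n) → (a ++ c) ⊕ (b ++ d) ≡ (a ⊕ b) ++ (c ⊕ d)
⊕-++ [] [] c d = refl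
⊕-++ (x ∷ a) (y ∷ b) c d = cong (_ ∷_) (⊕-++ a b c d)

parity4 : ∀ {A : Set} → (A → A → A) → (A → Bool) → (x y z w t : A) → Bool
parity4 _∙_ f x y z w t = (f (x ∙ t) xor f (y ∙ t)) xor (f (z ∙ t) xor f (w ∙ t))

Constant : ∀ {A : Set} → (A → Bool) → Set
Constant h = ∀ t t′ → h t ≡ h t′

Quadratic : ∀ {A : Set} → (A → A → A) → (A → Bool) → Set
Quadratic _∙_ f = ∀ x y z → Constant (parity4 _∙_ f x y z (x ∙ (y ∙ z)))

parity4-resp-≗ : ∀ {A : Set} (_∙_ : A → A → A) {f g : A → Bool} → f ≗ g →
  ∀ x y z w t → parity4 _∙_ f x y z w t ≡ parity4 _∙_ g x y z w t
parity4-resp-≗ _∙_ f≗g x y z w t =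
  cong₂ _xor_ (cong₂ _xor_ (f≗g (x ∙ t)) (f≗g (y ∙ t)))
              (cong₂ _xor_ (f≗g (z ∙ t)) (f≗g (w ∙ t)))

Quadratic-resp-≗ : ∀ {A : Set} {_∙_ : A → A → A} {f g : A → Bool} →
  f ≗ g → Quadratic _∙_ f → Quadratic _∙_ g
Quadratic-resp-≗ {_∙_ = _∙_} f≗g quadratic x y z t t′ =
  trans (sym (parity4-resp-≗ _∙_ f≗g x y z _ t))
    (trans (quadratic x y z t t′) (parity4-resp-≗ _∙_ f≗g x y z _ t′))

-- Every Boolean function of two bits has degree at most two.
isDigit1-quadratic : Quadratic _⊕ᵈ_ isDigit1
isDigit1-quadratic = from-yes
  (searchable-Digit λ x → searchable-Digit λ y → searchable-Digit λ z →
   searchable-Digit λ t → searchable-Digit λ t′ →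
   let P = parity4 _⊕ᵈ_ isDigit1 x y z (x ⊕ᵈ (y ⊕ᵈ z)) in P t ≟ P t′)

digitSum : ∀ {m} → (Digit → Bool) → V m → Bool
digitSum h [] = false
digitSum h (d ∷ ds) = h d xor digitSum h ds

xor-interchange₄ : ∀ a A b B c C d D →
  ((a xor A) xor (b xor B)) xor ((c xor C) xor (d xor D)) ≡
  ((a xor b) xor (c xor d)) xor ((A xor B) xor (C xor D))
xor-interchange₄ a A b B c C d D =
  trans (cong₂ _xor_ (interchange a A b B) (interchange c C d D))
        (interchange (a xor b) (A xor B) (c xor d) (C xor D))

parity4-digitSum-∷ : ∀ {m} (h : Digit → Bool) (p q r s u : Digit) (x y z w t : V m) →
  parity4 _⊕_ (digitSum h) (p ∷ x) (q ∷ y) (r ∷ z) (s ∷ w) (u ∷ t) ≡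
  parity4 _⊕ᵈ_ h p q r s u xor parity4 _⊕_ (digitSum h) x y z w t
parity4-digitSum-∷ {m} h p q r s u x y z w t =
  xor-interchange₄ (h (p ⊕ᵈ u)) (sum (x ⊕ t)) (h (q ⊕ᵈ u)) (sum (y ⊕ t))
                   (h (r ⊕ᵈ u)) (sum (z ⊕ t)) (h (s ⊕ᵈ u)) (sum (w ⊕ t))
  where
  sum : V m → Bool
  sum = digitSum h

digitSum-quadratic : ∀ {m} {h : Digit → Bool} →
  Quadratic _⊕ᵈ_ h → Quadratic (_⊕_ {m}) (digitSum h)
digitSum-quadratic quadratic [] [] [] [] [] = refl
digitSum-quadratic {h = h} quadratic (p ∷ x) (q ∷ y) (r ∷ z) (u ∷ t) (u′ ∷ t′) =
  trans (parity4-digitSum-∷ h p q r (p ⊕ᵈ (q ⊕ᵈ r)) u x y z (x ⊕ (y ⊕ z)) t)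
    (trans (cong₂ _xor_ (quadratic p q r u u′) (digitSum-quadratic quadratic x y z t t′))
      (sym (parity4-digitSum-∷ h p q r (p ⊕ᵈ (q ⊕ᵈ r)) u′ x y z (x ⊕ (y ⊕ z)) t′)))

isOdd-+ : ∀ a b → isOdd (a + b) ≡ isOdd a xor isOdd b
isOdd-+ zero b = refl
isOdd-+ (suc a) b = trans (cong not (isOdd-+ a b)) (not-distribˡ-xor (isOdd a) (isOdd b))

isOdd-b2n : ∀ b → isOdd (b2n b) ≡ b
isOdd-b2n false = refl
isOdd-b2n true = refl

σ≗digitSum : ∀ m → σ m ≗ digitSum isDigit1
σ≗digitSum zero [] = refl
σ≗digitSum (suc m) (d ∷ ds) =
  trans (isOdd-+ (b2n (isDigit1 d)) (count1 ds))
        (cong₂ _xor_ (isOdd-b2n (isDigit1 d)) (σ≗digitSum m ds))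

σ-quadratic : ∀ m → Quadratic _⊕_ (σ m)
σ-quadratic m =
  Quadratic-resp-≗ {_∙_ = _⊕_} (sym ∘ σ≗digitSum m) (digitSum-quadratic isDigit1-quadratic)

Completable : ∀ {m} → (V m → Bool) → Set
Completable {m} f = ∀ (x y z : V m) → ∃[ w ] Constant (parity4 _⊕_ f x y z w)

Quadratic⇒Completable : ∀ {m} {f : V m → Bool} → Quadratic _⊕_ f → Completable f
Quadratic⇒Completable quadratic x y z = x ⊕ (y ⊕ z) , quadratic x y z

CayAdj⇔ : ∀ {m} (f : V m → Bool) → f (𝟎 m) ≡ false →
  ∀ i j → CayAdj f i j ⇔ f (i ⊕ j) ≡ true
CayAdj⇔ f f𝟎 i j = mk⇔ proj₂ λ fij → (λ { refl → loopless fij }) , fij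
  where
  loopless : f (i ⊕ i) ≡ true → ⊥
  loopless fii with () ← trans (sym fii) (trans (cong f (⊕-self i)) f𝟎)

module _ {m} {f g : V m → Bool} (f𝟎 : f (𝟎 m) ≡ false) (g𝟎 : g (𝟎 m) ≡ false)
         (iso : CayIsomorphic f g) where

  open Bijection (proj₁ iso) using (strictlySurjective) renaming (to to φ)

  CayIsomorphic⇒≡ : ∀ i j → f (i ⊕ j) ≡ g (φ i ⊕ φ j)
  CayIsomorphic⇒≡ i j =
    ⇔→≡ (⇔-trans (⇔-sym (CayAdj⇔ f f𝟎 i j))
                  (⇔-trans (proj₂ iso i j) (CayAdj⇔ g g𝟎 (φ i) (φ j))))

  parity4-φ : ∀ x y z w t →
    parity4 _⊕_ f x y z w t ≡ parity4 _⊕_ g (φ x) (φ y) (φ z) (φ w) (φ t)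
  parity4-φ x y z w t =
    cong₂ _xor_ (cong₂ _xor_ (CayIsomorphic⇒≡ x t) (CayIsomorphic⇒≡ y t))
                (cong₂ _xor_ (CayIsomorphic⇒≡ z t) (CayIsomorphic⇒≡ w t))

  Completable-transport : Completable f → Completable g
  Completable-transport completable x′ y′ z′
    with strictlySurjective x′ | strictlySurjective y′ | strictlySurjective z′
  ... | x , refl | y , refl | z , refl with completable x y z
  ... | w , constant = φ w , constant-on-images
    where
    constant-on-images : Constant (parity4 _⊕_ g (φ x) (φ y) (φ z) (φ w))
    constant-on-images t′ t″ with strictlySurjective t′ | strictlySurjective t″
    ... | t , refl | u , refl =
      trans (sym (parity4-φ x y z w t)) (trans (constant t u) (parity4-φ x y z w u))

Summary : Set
Summary = Bool × Bool

summary : ∀ {n} → V n → Summary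
summary r = isOdd (count1 r) , isNonzero (count12 r)

summary-𝟎 : ∀ n → summary (𝟎 n) ≡ (false , false)
summary-𝟎 zero = refl
summary-𝟎 (suc n) = summary-𝟎 n

τ-block : ∀ {k} → V k → Summary → Bool
τ-block K (odd , nonzero) = (isNonzero (count12 K) ∨ nonzero) ∧ not (isOdd (count1 K) xor odd)

σ-𝟎 : ∀ m → σ m (𝟎 m) ≡ false
σ-𝟎 m = cong proj₁ (summary-𝟎 m)

τ-𝟎 : ∀ m → τ m (𝟎 m) ≡ false
τ-𝟎 m = cong (τ-block []) (summary-𝟎 m)

isNonzero-+ : ∀ a b → isNonzero (a + b) ≡ isNonzero a ∨ isNonzero b
isNonzero-+ zero b = refl
isNonzero-+ (suc a) b = refl

count1-++ : ∀ {k n} (K : V k) (r : V n) → count1 (K ++ r) ≡ count1 K + count1 r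
count1-++ [] r = refl
count1-++ (d ∷ K) r =
  trans (cong (b2n (isDigit1 d) +_) (count1-++ K r))
        (sym (+-assoc (b2n (isDigit1 d)) (count1 K) (count1 r)))

count12-++ : ∀ {k n} (K : V k) (r : V n) → count12 (K ++ r) ≡ count12 K + count12 r
count12-++ [] r = refl
count12-++ (d ∷ K) r =
  trans (cong (b2n (isDigit1 d) + b2n (isDigit2 d) +_) (count12-++ K r))
        (sym (+-assoc (b2n (isDigit1 d) + b2n (isDigit2 d)) (count12 K) (count12 r)))

τ-++ : ∀ {k n} (K : V k) (r : V n) → τ (k + n) (K ++ r) ≡ τ-block K (summary r)
τ-++ K r =
  cong₂ (λ nonzero odd → nonzero ∧ not odd)
    (trans (cong isNonzero (count12-++ K r)) (isNonzero-+ (count12 K) (count12 r)))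
    (trans (cong isOdd (count1-++ K r)) (isOdd-+ (count1 K) (count1 r)))

τ-⊕-++ : ∀ {k n} (K T : V k) (r s : V n) →
  τ (k + n) ((K ++ r) ⊕ (T ++ s)) ≡ τ-block (K ⊕ T) (summary (r ⊕ s))
τ-⊕-++ {k} {n} K T r s = trans (cong (τ (k + n)) (⊕-++ K T r s)) (τ-++ (K ⊕ T) (r ⊕ s))

blockParity : ∀ {k} (x y z w t : V k) → Summary × Summary → Bool
blockParity x y z w t (s , sʷ) =
  (τ-block (x ⊕ t) s xor τ-block (y ⊕ t) s) xor (τ-block (z ⊕ t) s xor τ-block (w ⊕ t) sʷ)

parity4-++ : ∀ {k n} (x y z w : V k) (r : V n) (t : V k) (s : V n) →
  parity4 _⊕_ (τ (k + n)) (x ++ 𝟎 n) (y ++ 𝟎 n) (z ++ 𝟎 n) (w ++ r) (t ++ s) ≡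
  blockParity x y z w t (summary s , summary (r ⊕ s))
parity4-++ {k} {n} x y z w r t s =
  cong₂ _xor_ (cong₂ _xor_ (zero-tail x) (zero-tail y))
              (cong₂ _xor_ (zero-tail z) (τ-⊕-++ w t r s))
  where
  zero-tail : ∀ u → τ (k + n) ((u ++ 𝟎 n) ⊕ (t ++ s)) ≡ τ-block (u ⊕ t) (summary s)
  zero-tail u = trans (τ-⊕-++ u t (𝟎 n) s) (cong (τ-block (u ⊕ t) ∘ summary) (⊕-identityˡ s))

e₀ e₁ : V 4
e₀ = (false , true) ∷ 𝟎 3
e₁ = (false , false) ∷ (false , true) ∷ 𝟎 2

-- The tail of a vertex t ++ s is either 𝟎 or the tail of w, which swaps the two summaries.
block-not-completable : ∀ (w : V 4) (s : Summary) →
  let P = blockParity (𝟎 4) e₀ e₁ w in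
  ¬ (∀ t → P t ((false , false) , s) ≡ P (𝟎 4) ((false , false) , s) ×
           P t (s , (false , false)) ≡ P (𝟎 4) ((false , false) , s))
block-not-completable = from-yes
  (searchable-Vec searchable-Digit 4 λ w → searchable-Digit λ s →
   let P = blockParity (𝟎 4) e₀ e₁ w in
   ¬? (searchable-Vec searchable-Digit 4 λ t →
       (P t ((false , false) , s) ≟ P (𝟎 4) ((false , false) , s)) ×-dec
       (P t (s , (false , false)) ≟ P (𝟎 4) ((false , false) , s))))

τ-not-completable : ∀ n → ¬ Completable (τ (4 + n))
τ-not-completable n completable
  with completable (𝟎 4 ++ 𝟎 n) (e₀ ++ 𝟎 n) (e₁ ++ 𝟎 n)
... | w , constant with splitAt 4 w
... | wK , wR , refl = block-not-completable wK (summary wR) λ t →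
  subst₂ (λ a b → P t a ≡ P (𝟎 4) b) tail-𝟎 tail-𝟎 (constant-on-blocks (𝟎 n) t) ,
  subst₂ (λ a b → P t a ≡ P (𝟎 4) b) tail-wR tail-𝟎 (constant-on-blocks wR t)
  where
  P : V 4 → Summary × Summary → Bool
  P = blockParity (𝟎 4) e₀ e₁ wK
  summaries : V n → Summary × Summary
  summaries s = summary s , summary (wR ⊕ s)
  constant-on-blocks : ∀ s t → P t (summaries s) ≡ P (𝟎 4) (summaries (𝟎 n))
  constant-on-blocks s t =
    trans (sym (parity4-++ (𝟎 4) e₀ e₁ wK wR t s))
      (trans (constant (t ++ s) (𝟎 4 ++ 𝟎 n)) (parity4-++ (𝟎 4) e₀ e₁ wK wR (𝟎 4) (𝟎 n)))
  tail-𝟎 : summaries (𝟎 n) ≡ ((false , false) , summary wR)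
  tail-𝟎 = cong₂ _,_ (summary-𝟎 n) (cong summary (⊕-identityʳ wR))
  tail-wR : summaries wR ≡ (summary wR , (false , false))
  tail-wR = cong (summary wR ,_) (trans (cong summary (⊕-self wR)) (summary-𝟎 n))

theorem1 : (m : ℕ) → 1 ≤ m → CayIsomorphic (σ m) (τ m) →
    (m ≡ 1) ⊎ (m ≡ 2) ⊎ (m ≡ 3)
theorem1 zero () _
theorem1 1 _ _ = inj₁ refl
theorem1 2 _ _ = inj₂ (inj₁ refl)
theorem1 3 _ _ = inj₂ (inj₂ refl)
theorem1 (suc (suc (suc (suc n)))) _ iso =
  ⊥-elim (τ-not-completable n
    (Completable-transport {f = σ m} {g = τ m} (σ-𝟎 m) (τ-𝟎 m) iso
      (Quadratic⇒Completable {f = σ m} (σ-quadratic m))))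
  where m = 4 + n
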